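{- Let $k\ge 1$ and let $L_i(m)=a_im+b_i$ for $i=1,\dots,k$ be an admissible $k$-tuple of linear forms. Suppose that for every pair of indices $i\neq j$ there are positive integers $c_{i,j}, c_{j,i}, n_{i,j}$ such that $|c_{i,j}L_i-c_{j,i}L_j|=n_{i,j}$ (a relation between $L_i$ and $L_j$). Let $r_1,\dots,r_k$ be positive integers such that $\gcd(r_i,a_i)=1$, $\gcd(r_i,\det(L_i,L_j))=1$ and $\gcd(r_i,r_j)=1$ whenever $i\neq j$. Then there is an admissible $k$-tuple of linear forms $K_1,\dots,K_k$ satisfying the relations $|c_{i,j}r_iK_i-c_{j,i}r_jK_j|=n_{i,j}$ for all $i\neq j$.
   Context: A linear form is an expression $L(m)=am+b$ with $a,b$ integers and $a>0$, viewed both as a polynomial and as a function of $m$; it is reduced if $\gcd(a,b)=1$. For linear forms $L$ and $K$, a relation between them is an identity of polynomials $|c_L\cdot L-c_K\cdot K|=n$ (i.e. $c_L L - c_K K$ is the constant polynomial $n$ or $-n$) with $c_L,c_K,n$ positive integers; $c_L,c_K$ are the relation coefficients and $n$ the relation value. For $L(m)=am+b$ and $K(m)=cm+d$, the determinant is $\det(L,K)=|ad-bc|$. For a prime $p$, a $k$-tuple $L_1,\dots,L_k$ of linear forms is $p$-admissible if there is an integer $t$ with $L_1(t)L_2(t)\cdots L_k(t)\not\equiv 0 \pmod p$; it is admissible if it is $p$-admissible for every prime $p$. -}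

module Defs where

open import Data.Nat as ℕ using (ℕ; zero; suc)
open import Data.Integer as ℤ using (ℤ; +_; ∣_∣)
open import Data.Integer.Divisibility using () renaming (_∣_ to _∣ℤ_)
open import Data.Nat.Primality using (Prime)
open import Data.Fin using (Fin)
import Data.Fin as Fin
open import Data.Product using (Σ; ∃; _×_)
open import Data.Sum using (_⊎_)
open import Relation.Nullary using (¬_)
open import Relation.Binary.PropositionalEquality using (_≡_)

record LinForm : Set where
  constructor lin
  field
    a     : ℕ
    b     : ℤ
    a-pos : 0 ℕ.< a
open LinForm public

eval : LinForm → ℤ → ℤ
eval L m = (+ a L) ℤ.* m ℤ.+ b L

det : LinForm → LinForm → ℕ
det L K = ∣ (+ a L) ℤ.* b K ℤ.- b L ℤ.* (+ a K) ∣

-- A relation |cL·L - cK·K| = n as an identity of polynomials: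
-- cL·L - cK·K is the constant polynomial n or -n, with cL, cK, n positive.
RelationWith : LinForm → LinForm → ℕ → ℕ → ℕ → Set
RelationWith L K cL cK n =
  (0 ℕ.< cL) × (0 ℕ.< cK) × (0 ℕ.< n) ×
  ((+ cL) ℤ.* (+ a L) ℤ.- (+ cK) ℤ.* (+ a K) ≡ + 0) ×
  (((+ cL) ℤ.* b L ℤ.- (+ cK) ℤ.* b K ≡ + n) ⊎
   ((+ cL) ℤ.* b L ℤ.- (+ cK) ℤ.* b K ≡ ℤ.- (+ n)))

prodFin : (k : ℕ) → (Fin k → ℤ) → ℤ
prodFin zero    f = + 1
prodFin (suc k) f = f Fin.zero ℤ.* prodFin k (λ i → f (Fin.suc i))

PAdmissible : (k : ℕ) → (Fin k → LinForm) → ℕ → Set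
PAdmissible k L p = ∃ λ (t : ℤ) → ¬ ((+ p) ∣ℤ prodFin k (λ i → eval (L i) t))

Admissible : (k : ℕ) → (Fin k → LinForm) → Set
Admissible k L = (p : ℕ) → Prime p → PAdmissible k L p

{-# OPTIONS --safe #-}
-- Put R = ∏ rᵢ. By the Chinese remainder theorem there is t with rᵢ ∣ Lᵢ(t) for all i, and then
-- Lᵢ(R m + t) = rᵢ Kᵢ(m) for the linear form Kᵢ(m) = aᵢ (R / rᵢ) m + Lᵢ(t) / rᵢ. A relation between
-- Lᵢ and Lⱼ is a polynomial identity, so it survives the substitution m ↦ R m + t and becomes the
-- required relation between rᵢ Kᵢ and rⱼ Kⱼ. For a prime p ∤ R the substitution is onto modulo p,
-- so p-admissibility passes from the Lᵢ to the Kᵢ. For p ∣ rᵢ, every Kⱼ with j ≠ i is congruent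
-- modulo p to the constant Lⱼ(t) / rⱼ, a unit because p ∤ det(Lᵢ, Lⱼ), while the leading
-- coefficient of Kᵢ is prime to p; so Kᵢ alone decides whether the product vanishes.
module Submission where

open import Defs
open import Data.Nat using (ℕ; _≤_; _<_; _*_)
open import Data.Nat.GCD using (gcd)
open import Data.Fin using (Fin)
open import Data.Product using (Σ; ∃; _×_)
open import Relation.Nullary using (¬_)
open import Relation.Binary.PropositionalEquality using (_≡_)

open import Data.Nat using (zero; suc; s≤s; z≤n; nonTrivial⇒≢1)
open import Data.Fin using (zero; suc; _≟_)
import Data.Nat.Properties as ℕ
open import Algebra.Properties.CommutativeSemigroup ℕ.*-commutativeSemigroup using (x∙yz≈y∙xz)
open import Data.Nat.Divisibility using (_∣_; _∣?_; _∣0; ∣-trans; ∣1⇒≡1; m∣m*n; ∣n⇒∣m*n)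
open import Data.Nat.Coprimality as Coprime using (Coprime; coprime-divisor; coprime-Bézout; gcd≡1⇒coprime)
open import Data.Nat.GCD using (module Bézout)
open import Data.Nat.Primality using (Prime; euclidsLemma; prime⇒irreducible; prime⇒nonTrivial)
open import Data.Integer as ℤ using (ℤ; +_; -_; ∣_∣)
import Data.Integer.Properties as ℤ
open import Data.Integer.Divisibility.Signed as ℤ∣ using (divides; ∣ᵤ⇒∣; ∣⇒∣ᵤ) renaming (_∣_ to _∣ℤ_)
open import Data.Integer.Tactic.RingSolver using (solve-∀)
open import Algebra.Properties.Semiring.Sum ℤ.+-*-semiring using (sum; *-distribˡ-sum)
open import Data.Fin.Properties using (suc-injective)
open import Data.Product using (_,_; proj₁; proj₂)
open import Data.Sum using (inj₁; inj₂)
import Data.Sum as Sum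
open import Data.Empty using (⊥-elim)
open import Function using (_∘_)
open import Relation.Nullary using (Dec; yes; no)
open import Relation.Binary.PropositionalEquality using (_≢_; refl; sym; trans; cong; cong₂; subst; module ≡-Reasoning)

*-positive : ∀ {x y} → 0 < x → 0 < y → 0 < x * y
*-positive {suc x} {suc y} _ _ = s≤s z≤n

prime≢1 : ∀ {p} → Prime p → p ≢ 1
prime≢1 pp = nonTrivial⇒≢1 {{prime⇒nonTrivial pp}}

prime∤1 : ∀ {p} → Prime p → ¬ p ∣ 1
prime∤1 pp = prime≢1 pp ∘ ∣1⇒≡1

prime∤⇒coprime : ∀ {p n} → Prime p → ¬ p ∣ n → Coprime p n
prime∤⇒coprime pp p∤n (d∣p , d∣n) with prime⇒irreducible pp d∣p
... | inj₁ d≡1 = d≡1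
... | inj₂ refl = ⊥-elim (p∤n d∣n)

coprime-* : ∀ {x y z} → Coprime x y → Coprime x z → Coprime x (y * z)
coprime-* x⊥y x⊥z (d∣x , d∣yz) =
  x⊥z (d∣x , coprime-divisor (λ (e∣d , e∣y) → x⊥y (∣-trans e∣d d∣x , e∣y)) d∣yz)

prodFinℕ : (k : ℕ) → (Fin k → ℕ) → ℕ
prodFinℕ zero    f = 1
prodFinℕ (suc k) f = f zero * prodFinℕ k (f ∘ suc)

prodFinℕ-except : (k : ℕ) → Fin k → (Fin k → ℕ) → ℕ
prodFinℕ-except (suc k) zero    f = prodFinℕ k (f ∘ suc)
prodFinℕ-except (suc k) (suc i) f = f zero * prodFinℕ-except k i (f ∘ suc)

*-prodFinℕ-except : ∀ k i f → f i * prodFinℕ-except k i f ≡ prodFinℕ k f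
*-prodFinℕ-except (suc k) zero    f = refl
*-prodFinℕ-except (suc k) (suc i) f = begin
  f (suc i) * (f zero * prodFinℕ-except k i (f ∘ suc)) ≡⟨ x∙yz≈y∙xz (f (suc i)) (f zero) _ ⟩
  f zero * (f (suc i) * prodFinℕ-except k i (f ∘ suc)) ≡⟨ cong (f zero *_) (*-prodFinℕ-except k i (f ∘ suc)) ⟩
  f zero * prodFinℕ k (f ∘ suc)                         ∎
  where open ≡-Reasoning

∣prodFinℕ : ∀ k j f → f j ∣ prodFinℕ k f
∣prodFinℕ (suc k) zero    f = m∣m*n _
∣prodFinℕ (suc k) (suc j) f = ∣n⇒∣m*n (f zero) (∣prodFinℕ k j (f ∘ suc))

∣prodFinℕ-except : ∀ k i j f → j ≢ i → f j ∣ prodFinℕ-except k i f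
∣prodFinℕ-except (suc k) zero    zero    f j≢i = ⊥-elim (j≢i refl)
∣prodFinℕ-except (suc k) zero    (suc j) f j≢i = ∣prodFinℕ k j (f ∘ suc)
∣prodFinℕ-except (suc k) (suc i) zero    f j≢i = m∣m*n _
∣prodFinℕ-except (suc k) (suc i) (suc j) f j≢i =
  ∣n⇒∣m*n (f zero) (∣prodFinℕ-except k i j (f ∘ suc) (j≢i ∘ cong suc))

prodFinℕ-pos : ∀ k f → (∀ i → 0 < f i) → 0 < prodFinℕ k f
prodFinℕ-pos zero    f f>0 = s≤s z≤n
prodFinℕ-pos (suc k) f f>0 = *-positive (f>0 zero) (prodFinℕ-pos k (f ∘ suc) (f>0 ∘ suc))

prodFinℕ-except-pos : ∀ k i f → (∀ i → 0 < f i) → 0 < prodFinℕ-except k i f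
prodFinℕ-except-pos (suc k) zero    f f>0 = prodFinℕ-pos k (f ∘ suc) (f>0 ∘ suc)
prodFinℕ-except-pos (suc k) (suc i) f f>0 =
  *-positive (f>0 zero) (prodFinℕ-except-pos k i (f ∘ suc) (f>0 ∘ suc))

coprime-prodFinℕ : ∀ {x} k f → (∀ j → Coprime x (f j)) → Coprime x (prodFinℕ k f)
coprime-prodFinℕ zero    f x⊥f = Coprime.sym (Coprime.1-coprimeTo _)
coprime-prodFinℕ (suc k) f x⊥f = coprime-* (x⊥f zero) (coprime-prodFinℕ k (f ∘ suc) (x⊥f ∘ suc))

coprime-prodFinℕ-except : ∀ {x} k i f → (∀ j → j ≢ i → Coprime x (f j)) →
                          Coprime x (prodFinℕ-except k i f)
coprime-prodFinℕ-except (suc k) zero    f x⊥f = coprime-prodFinℕ k (f ∘ suc) (λ j → x⊥f (suc j) λ ())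
coprime-prodFinℕ-except (suc k) (suc i) f x⊥f =
  coprime-* (x⊥f zero λ ()) (coprime-prodFinℕ-except k i (f ∘ suc) (λ j j≢i → x⊥f (suc j) (j≢i ∘ suc-injective)))

coprime-*-prodFinℕ-except : ∀ {x} k i r → (∀ i j → i ≢ j → Coprime (r i) (r j)) →
                            Coprime (r i) x → Coprime (r i) (x * prodFinℕ-except k i r)
coprime-*-prodFinℕ-except k i r r⊥r rᵢ⊥x =
  coprime-* rᵢ⊥x (coprime-prodFinℕ-except k i r λ j j≢i → r⊥r i j (j≢i ∘ sym))

prime∣prodFinℕ⇒∣ : ∀ {p} → Prime p → ∀ k f → p ∣ prodFinℕ k f → ∃ λ i → p ∣ f i
prime∣prodFinℕ⇒∣ pp zero    f p∣1 = ⊥-elim (prime∤1 pp p∣1)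
prime∣prodFinℕ⇒∣ pp (suc k) f p∣f₀*∏ with euclidsLemma _ _ pp p∣f₀*∏
... | inj₁ p∣f₀ = zero , p∣f₀
... | inj₂ p∣∏  with i , p∣fᵢ ← prime∣prodFinℕ⇒∣ pp k (f ∘ suc) p∣∏ = suc i , p∣fᵢ

∣sum : ∀ {d} k (f : Fin k → ℤ) → (∀ j → d ∣ℤ f j) → d ∣ℤ sum f
∣sum zero    f d∣f = ∣ᵤ⇒∣ (_ ∣0)
∣sum (suc k) f d∣f = ℤ∣.∣m∣n⇒∣m+n (d∣f zero) (∣sum k (f ∘ suc) (d∣f ∘ suc))

∣sum-except : ∀ {d} k i (f : Fin k → ℤ) e → (∀ j → j ≢ i → d ∣ℤ f j) →
              d ∣ℤ f i ℤ.+ e → d ∣ℤ sum f ℤ.+ e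
∣sum-except {d} (suc k) zero f e d∣f d∣fᵢ+e =
  subst (d ∣ℤ_) (swap (f zero) (sum (f ∘ suc)) e)
        (ℤ∣.∣m∣n⇒∣m+n d∣fᵢ+e (∣sum k (f ∘ suc) (λ j → d∣f (suc j) λ ())))
  where
  swap : ∀ x s e → (x ℤ.+ e) ℤ.+ s ≡ (x ℤ.+ s) ℤ.+ e
  swap = solve-∀
∣sum-except {d} (suc k) (suc i) f e d∣f d∣fᵢ+e =
  subst (d ∣ℤ_) (sym (ℤ.+-assoc (f zero) (sum (f ∘ suc)) e))
        (ℤ∣.∣m∣n⇒∣m+n (d∣f zero λ ())
                      (∣sum-except k i (f ∘ suc) e (λ j j≢i → d∣f (suc j) (j≢i ∘ suc-injective)) d∣fᵢ+e))

pos-suc-*≡* : ∀ a b c d → suc (a * b) ≡ c * d → + 1 ℤ.+ + a ℤ.* + b ≡ + c ℤ.* + d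
pos-suc-*≡* a b c d e = begin
  + 1 ℤ.+ + a ℤ.* + b   ≡⟨ cong (λ z → + 1 ℤ.+ z) (ℤ.pos-* a b) ⟨
  + suc (a * b)         ≡⟨ cong +_ e ⟩
  + (c * d)             ≡⟨ ℤ.pos-* c d ⟩
  + c ℤ.* + d           ∎
  where open ≡-Reasoning

coprime⇒∃inverse : ∀ {m n} → Coprime m n → ∃ λ u → + m ∣ℤ u ℤ.* + n ℤ.- + 1
coprime⇒∃inverse {m} {n} m⊥n with coprime-Bézout m⊥n
... | Bézout.+- x y 1+yn≡xm = - + y , divides (- + x) (begin
  - + y ℤ.* + n ℤ.- + 1       ≡⟨ negate (+ y) (+ n) ⟩
  - (+ 1 ℤ.+ + y ℤ.* + n)     ≡⟨ cong -_ (pos-suc-*≡* y n x m 1+yn≡xm) ⟩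
  - (+ x ℤ.* + m)             ≡⟨ ℤ.neg-distribˡ-* (+ x) (+ m) ⟩
  - + x ℤ.* + m               ∎)
  where
  open ≡-Reasoning
  negate : ∀ y n → - y ℤ.* n ℤ.- + 1 ≡ - (+ 1 ℤ.+ y ℤ.* n)
  negate = solve-∀
... | Bézout.-+ x y 1+xm≡yn = + y , divides (+ x) (begin
  + y ℤ.* + n ℤ.- + 1         ≡⟨ cong (λ z → z ℤ.- + 1) (pos-suc-*≡* x m y n 1+xm≡yn) ⟨
  + 1 ℤ.+ + x ℤ.* + m ℤ.- + 1 ≡⟨ cancel (+ x ℤ.* + m) ⟩
  + x ℤ.* + m                 ∎)
  where
  open ≡-Reasoning
  cancel : ∀ z → + 1 ℤ.+ z ℤ.- + 1 ≡ z
  cancel = solve-∀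

linear-congruences-solvable :
  ∀ k (r a : Fin k → ℕ) (b : Fin k → ℤ) →
  (∀ i j → i ≢ j → Coprime (r i) (r j)) → (∀ i → Coprime (r i) (a i)) →
  ∃ λ t → ∀ i → + r i ∣ℤ + a i ℤ.* t ℤ.+ b i
linear-congruences-solvable k r a b r⊥r r⊥a = t , r∣L
  where
  P : Fin k → ℕ
  P i = prodFinℕ-except k i r

  inverse : ∀ i → ∃ λ u → + r i ∣ℤ u ℤ.* + (a i * P i) ℤ.- + 1
  inverse i = coprime⇒∃inverse (coprime-*-prodFinℕ-except k i r r⊥r (r⊥a i))

  u : Fin k → ℤ
  u i = proj₁ (inverse i)

  -- modulo rᵢ only the i-th summand survives, and aᵢ uᵢ Pᵢ ≡ 1 turns aᵢ times it into −bᵢ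
  t : ℤ
  t = sum {k} λ j → - (b j ℤ.* u j ℤ.* + P j)

  r∣L : ∀ i → + r i ∣ℤ + a i ℤ.* t ℤ.+ b i
  r∣L i = subst (λ z → + r i ∣ℤ z ℤ.+ b i) (sym (*-distribˡ-sum {k} (+ a i) _))
                (∣sum-except k i _ (b i) r∣off r∣on)
    where
    r∣off : ∀ j → j ≢ i → + r i ∣ℤ + a i ℤ.* - (b j ℤ.* u j ℤ.* + P j)
    r∣off j j≢i = ℤ∣.∣n⇒∣m*n (+ a i) (ℤ∣.∣m⇒∣-m (ℤ∣.∣n⇒∣m*n (b j ℤ.* u j)
                    (∣ᵤ⇒∣ (∣prodFinℕ-except k j i r (j≢i ∘ sym)))))

    regroup : ∀ a b u p → - (b ℤ.* (u ℤ.* (a ℤ.* p) ℤ.- + 1)) ≡ a ℤ.* - (b ℤ.* u ℤ.* p) ℤ.+ b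
    regroup = solve-∀

    r∣on : + r i ∣ℤ + a i ℤ.* - (b i ℤ.* u i ℤ.* + P i) ℤ.+ b i
    r∣on = subst (+ r i ∣ℤ_)
      (trans (cong (λ z → - (b i ℤ.* (u i ℤ.* z ℤ.- + 1))) (ℤ.pos-* (a i) (P i)))
             (regroup (+ a i) (b i) (u i) (+ P i)))
      (ℤ∣.∣m⇒∣-m (ℤ∣.∣n⇒∣m*n (b i) (proj₂ (inverse i))))

precompose : (R : ℕ) → 0 < R → ℤ → LinForm → LinForm
precompose R R>0 t L = lin (a L * R) (+ a L ℤ.* t ℤ.+ b L) (*-positive (a-pos L) R>0)

eval-precompose : ∀ R R>0 t L m → eval (precompose R R>0 t L) m ≡ eval L (+ R ℤ.* m ℤ.+ t)
eval-precompose R R>0 t L m = begin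
  + (a L * R) ℤ.* m ℤ.+ (+ a L ℤ.* t ℤ.+ b L)   ≡⟨ cong (λ z → z ℤ.* m ℤ.+ (+ a L ℤ.* t ℤ.+ b L)) (ℤ.pos-* (a L) R) ⟩
  + a L ℤ.* + R ℤ.* m ℤ.+ (+ a L ℤ.* t ℤ.+ b L) ≡⟨ regroup (+ a L) (+ R) m t (b L) ⟩
  + a L ℤ.* (+ R ℤ.* m ℤ.+ t) ℤ.+ b L          ∎
  where
  open ≡-Reasoning
  regroup : ∀ a R m t b → a ℤ.* R ℤ.* m ℤ.+ (a ℤ.* t ℤ.+ b) ≡ a ℤ.* (R ℤ.* m ℤ.+ t) ℤ.+ b
  regroup = solve-∀

relation-precompose : ∀ {L K c c′ n} R R>0 t → RelationWith L K c c′ n →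
                      RelationWith (precompose R R>0 t L) (precompose R R>0 t K) c c′ n
relation-precompose {L} {K} {c} {c′} R R>0 t (c>0 , c′>0 , n>0 , lead , const) =
  c>0 , c′>0 , n>0 , lead′ , Sum.map (trans const′) (trans const′) const
  where
  open ≡-Reasoning
  δ : ℤ
  δ = + c ℤ.* + a L ℤ.- + c′ ℤ.* + a K

  factor : ∀ c a c′ a′ R → c ℤ.* (a ℤ.* R) ℤ.- c′ ℤ.* (a′ ℤ.* R) ≡ (c ℤ.* a ℤ.- c′ ℤ.* a′) ℤ.* R
  factor = solve-∀

  expand : ∀ c a c′ a′ t b b′ → c ℤ.* (a ℤ.* t ℤ.+ b) ℤ.- c′ ℤ.* (a′ ℤ.* t ℤ.+ b′)
                                ≡ (c ℤ.* a ℤ.- c′ ℤ.* a′) ℤ.* t ℤ.+ (c ℤ.* b ℤ.- c′ ℤ.* b′)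
  expand = solve-∀

  lead′ : + c ℤ.* + (a L * R) ℤ.- + c′ ℤ.* + (a K * R) ≡ + 0
  lead′ = begin
    + c ℤ.* + (a L * R) ℤ.- + c′ ℤ.* + (a K * R)           ≡⟨ cong₂ (λ x y → + c ℤ.* x ℤ.- + c′ ℤ.* y) (ℤ.pos-* (a L) R) (ℤ.pos-* (a K) R) ⟩
    + c ℤ.* (+ a L ℤ.* + R) ℤ.- + c′ ℤ.* (+ a K ℤ.* + R)   ≡⟨ factor (+ c) (+ a L) (+ c′) (+ a K) (+ R) ⟩
    δ ℤ.* + R                                              ≡⟨ cong (ℤ._* + R) lead ⟩
    + 0                                                    ∎

  const′ : + c ℤ.* (+ a L ℤ.* t ℤ.+ b L) ℤ.- + c′ ℤ.* (+ a K ℤ.* t ℤ.+ b K)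
           ≡ + c ℤ.* b L ℤ.- + c′ ℤ.* b K
  const′ = begin
    + c ℤ.* (+ a L ℤ.* t ℤ.+ b L) ℤ.- + c′ ℤ.* (+ a K ℤ.* t ℤ.+ b K) ≡⟨ expand (+ c) (+ a L) (+ c′) (+ a K) t (b L) (b K) ⟩
    δ ℤ.* t ℤ.+ (+ c ℤ.* b L ℤ.- + c′ ℤ.* b K)                      ≡⟨ cong (λ z → z ℤ.* t ℤ.+ (+ c ℤ.* b L ℤ.- + c′ ℤ.* b K)) lead ⟩
    + 0 ℤ.+ (+ c ℤ.* b L ℤ.- + c′ ℤ.* b K)                          ≡⟨ ℤ.+-identityˡ _ ⟩
    + c ℤ.* b L ℤ.- + c′ ℤ.* b K                                    ∎

infix 4 _≐_·_
record _≐_·_ (L : LinForm) (x : ℕ) (K : LinForm) : Set where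
  constructor _,_
  field
    leading  : + x ℤ.* + a K ≡ + a L
    constant : + x ℤ.* b K ≡ b L

≐·⇒pos : ∀ {L x K} → L ≐ x · K → 0 < x
≐·⇒pos {L} {zero} (lead , _) with () ← subst (0 <_) (sym (ℤ.+-injective lead)) (a-pos L)
≐·⇒pos {L} {suc x} _ = s≤s z≤n

eval-≐· : ∀ {L x K} → L ≐ x · K → ∀ m → eval L m ≡ + x ℤ.* eval K m
eval-≐· {L} {x} {K} (lead , const) m = begin
  + a L ℤ.* m ℤ.+ b L                       ≡⟨ cong₂ (λ α β → α ℤ.* m ℤ.+ β) lead const ⟨
  + x ℤ.* + a K ℤ.* m ℤ.+ + x ℤ.* b K       ≡⟨ distrib (+ x) (+ a K) m (b K) ⟩
  + x ℤ.* (+ a K ℤ.* m ℤ.+ b K)             ∎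
  where
  open ≡-Reasoning
  distrib : ∀ x a m b → x ℤ.* a ℤ.* m ℤ.+ x ℤ.* b ≡ x ℤ.* (a ℤ.* m ℤ.+ b)
  distrib = solve-∀

relation-≐· : ∀ {L L′ K K′ x x′ c c′ n} → L ≐ x · K → L′ ≐ x′ · K′ →
              RelationWith L L′ c c′ n → RelationWith K K′ (c * x) (c′ * x′) n
relation-≐· {L} {L′} {K} {K′} {x} {x′} {c} {c′} L≐xK@(lead , const) L′≐x′K′@(lead′ , const′)
            (c>0 , c′>0 , n>0 , leadL , constL) =
  *-positive c>0 (≐·⇒pos L≐xK) , *-positive c′>0 (≐·⇒pos L′≐x′K′) , n>0 ,
  trans (cong₂ ℤ._-_ (rescale c lead) (rescale c′ lead′)) leadL ,
  Sum.map (trans constK≡constL) (trans constK≡constL) constL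
  where
  rescale : ∀ d {y v w} → + y ℤ.* v ≡ w → + (d * y) ℤ.* v ≡ + d ℤ.* w
  rescale d {y} {v} {w} yv≡w = begin
    + (d * y) ℤ.* v       ≡⟨ cong (ℤ._* v) (ℤ.pos-* d y) ⟩
    + d ℤ.* + y ℤ.* v     ≡⟨ ℤ.*-assoc (+ d) (+ y) v ⟩
    + d ℤ.* (+ y ℤ.* v)   ≡⟨ cong (λ z → + d ℤ.* z) yv≡w ⟩
    + d ℤ.* w             ∎
    where open ≡-Reasoning

  constK≡constL : + (c * x) ℤ.* b K ℤ.- + (c′ * x′) ℤ.* b K′ ≡ + c ℤ.* b L ℤ.- + c′ ℤ.* b L′
  constK≡constL = cong₂ ℤ._-_ (rescale c const) (rescale c′ const′)

∣eval⇒∣det : ∀ {d} L K t → + d ∣ℤ eval L t → + d ∣ℤ eval K t → d ∣ det L K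
∣eval⇒∣det {d} L K t d∣L d∣K = ∣⇒∣ᵤ (subst (+ d ∣ℤ_) (cancel (+ a L) (+ a K) t (b L) (b K))
  (ℤ∣.∣m∣n⇒∣m-n (ℤ∣.∣n⇒∣m*n (+ a L) d∣K) (ℤ∣.∣n⇒∣m*n (+ a K) d∣L)))
  where
  cancel : ∀ a a′ t b b′ → a ℤ.* (a′ ℤ.* t ℤ.+ b′) ℤ.- a′ ℤ.* (a ℤ.* t ℤ.+ b) ≡ a ℤ.* b′ ℤ.- b ℤ.* a′
  cancel = solve-∀

prodFin-cong : ∀ k f g → (∀ i → f i ≡ g i) → prodFin k f ≡ prodFin k g
prodFin-cong zero    f g f≗g = refl
prodFin-cong (suc k) f g f≗g = cong₂ ℤ._*_ (f≗g zero) (prodFin-cong k (f ∘ suc) (g ∘ suc) (f≗g ∘ suc))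

prodFin-* : ∀ k f g → prodFin k (λ i → f i ℤ.* g i) ≡ prodFin k f ℤ.* prodFin k g
prodFin-* zero    f g = refl
prodFin-* (suc k) f g = begin
  f zero ℤ.* g zero ℤ.* prodFin k (λ i → f (suc i) ℤ.* g (suc i))  ≡⟨ cong (λ z → f zero ℤ.* g zero ℤ.* z) (prodFin-* k (f ∘ suc) (g ∘ suc)) ⟩
  f zero ℤ.* g zero ℤ.* (prodFin k (f ∘ suc) ℤ.* prodFin k (g ∘ suc)) ≡⟨ interchange (f zero) (g zero) _ _ ⟩
  f zero ℤ.* prodFin k (f ∘ suc) ℤ.* (g zero ℤ.* prodFin k (g ∘ suc)) ∎
  where
  open ≡-Reasoning
  interchange : ∀ a b c d → a ℤ.* b ℤ.* (c ℤ.* d) ≡ a ℤ.* c ℤ.* (b ℤ.* d)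
  interchange = solve-∀

prodFin-congruent : ∀ {d} k f g → (∀ i → d ∣ℤ f i ℤ.- g i) → d ∣ℤ prodFin k f ℤ.- prodFin k g
prodFin-congruent zero    f g d∣f-g = ∣ᵤ⇒∣ (_ ∣0)
prodFin-congruent {d} (suc k) f g d∣f-g =
  subst (d ∣ℤ_) (split (f zero) (prodFin k (f ∘ suc)) (g zero) (prodFin k (g ∘ suc)))
    (ℤ∣.∣m∣n⇒∣m+n (ℤ∣.∣n⇒∣m*n (f zero) (prodFin-congruent k (f ∘ suc) (g ∘ suc) (d∣f-g ∘ suc)))
                  (ℤ∣.∣m⇒∣m*n (prodFin k (g ∘ suc)) (d∣f-g zero)))
  where
  split : ∀ x y x′ y′ → x ℤ.* (y ℤ.- y′) ℤ.+ (x ℤ.- x′) ℤ.* y′ ≡ x ℤ.* y ℤ.- x′ ℤ.* y′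
  split = solve-∀

prime∤prodFin : ∀ {p} → Prime p → ∀ k f → (∀ i → ¬ p ∣ ∣ f i ∣) → ¬ p ∣ ∣ prodFin k f ∣
prime∤prodFin pp zero    f p∤f = prime∤1 pp
prime∤prodFin pp (suc k) f p∤f p∣∏
  with euclidsLemma _ _ pp (subst (_ ∣_) (ℤ.abs-* (f zero) (prodFin k (f ∘ suc))) p∣∏)
... | inj₁ p∣f₀ = p∤f zero p∣f₀
... | inj₂ p∣∏′ = prime∤prodFin pp k (f ∘ suc) (p∤f ∘ suc) p∣∏′

eval-congruent : ∀ {d} L {x y} → d ∣ℤ x ℤ.- y → d ∣ℤ eval L x ℤ.- eval L y
eval-congruent {d} L {x} {y} d∣x-y =
  subst (d ∣ℤ_) (difference (+ a L) x y (b L)) (ℤ∣.∣n⇒∣m*n (+ a L) d∣x-y)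
  where
  difference : ∀ a x y b → a ℤ.* (x ℤ.- y) ≡ (a ℤ.* x ℤ.+ b) ℤ.- (a ℤ.* y ℤ.+ b)
  difference = solve-∀

pAdmissible-≐· : ∀ {k p} {L K : Fin k → LinForm} (x : Fin k → ℕ) → (∀ i → L i ≐ x i · K i) →
                 PAdmissible k L p → PAdmissible k K p
pAdmissible-≐· {k} {p} {L} {K} x L≐xK (t , p∤L[t]) = t , λ p∣K[t] → p∤L[t] (∣⇒∣ᵤ (subst (+ p ∣ℤ_) (sym ∏L≡∏x*∏K)
  (ℤ∣.∣n⇒∣m*n (prodFin k (λ i → + x i)) (∣ᵤ⇒∣ p∣K[t]))))
  where
  ∏L≡∏x*∏K : prodFin k (λ i → eval (L i) t) ≡ prodFin k (λ i → + x i) ℤ.* prodFin k (λ i → eval (K i) t)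
  ∏L≡∏x*∏K = trans (prodFin-cong k _ _ λ i → eval-≐· (L≐xK i) t) (prodFin-* k _ _)

pAdmissible-precompose : ∀ {k p} {L : Fin k → LinForm} R R>0 t → Coprime p R →
                         PAdmissible k L p → PAdmissible k (precompose R R>0 t ∘ L) p
pAdmissible-precompose {k} {p} {L} R R>0 t p⊥R (t₀ , p∤L[t₀]) = s , p∤L[t₀] ∘ ∣⇒∣ᵤ ∘ p∣L[t₀]
  where
  u : ℤ
  u = proj₁ (coprime⇒∃inverse p⊥R)

  s : ℤ
  s = u ℤ.* (t₀ ℤ.- t)

  shift : ∀ u R t₀ t → (u ℤ.* R ℤ.- + 1) ℤ.* (t₀ ℤ.- t) ≡ (R ℤ.* (u ℤ.* (t₀ ℤ.- t)) ℤ.+ t) ℤ.- t₀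
  shift = solve-∀

  p∣Rs+t-t₀ : + p ∣ℤ (+ R ℤ.* s ℤ.+ t) ℤ.- t₀
  p∣Rs+t-t₀ = subst (+ p ∣ℤ_) (shift u (+ R) t₀ t) (ℤ∣.∣m⇒∣m*n (t₀ ℤ.- t) (proj₂ (coprime⇒∃inverse p⊥R)))

  X Y : ℤ
  X = prodFin k (λ i → eval (precompose R R>0 t (L i)) s)
  Y = prodFin k (λ i → eval (L i) t₀)

  X-Y : X ℤ.- Y ≡ prodFin k (λ i → eval (L i) (+ R ℤ.* s ℤ.+ t)) ℤ.- Y
  X-Y = cong (ℤ._- Y) (prodFin-cong k _ _ λ i → eval-precompose R R>0 t (L i) s)

  cancel : ∀ x y → x ℤ.- (x ℤ.- y) ≡ y
  cancel = solve-∀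

  p∣L[t₀] : p ∣ ∣ X ∣ → + p ∣ℤ Y
  p∣L[t₀] p∣X = subst (+ p ∣ℤ_) (cancel X Y)
    (ℤ∣.∣m∣n⇒∣m-n (∣ᵤ⇒∣ {i = X} p∣X)
                  (subst (+ p ∣ℤ_) (sym X-Y) (prodFin-congruent k _ _ λ i → eval-congruent (L i) p∣Rs+t-t₀)))

pAdmissible-one-nonconstant :
  ∀ {k p} {K : Fin k → LinForm} → Prime p → (i : Fin k) → ¬ p ∣ a (K i) →
  (∀ j → j ≢ i → p ∣ a (K j) × ¬ + p ∣ℤ b (K j)) → PAdmissible k K p
pAdmissible-one-nonconstant {k} {p} {K} pp i p∤aᵢ others = witness (+ p ℤ∣.∣? b (K i))
  where
  p∣a*m : ∀ α m → p ∣ α → + p ∣ℤ + α ℤ.* m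
  p∣a*m α m p∣α = ℤ∣.∣m⇒∣m*n m (∣ᵤ⇒∣ {i = + α} p∣α)

  p∤K[m] : ∀ m → ¬ + p ∣ℤ eval (K i) m → ∀ j → ¬ p ∣ ∣ eval (K j) m ∣
  p∤K[m] m p∤Kᵢ[m] j with j ≟ i
  ... | yes refl = p∤Kᵢ[m] ∘ ∣ᵤ⇒∣
  ... | no j≢i   = λ p∣Kⱼ[m] → proj₂ (others j j≢i)
    (ℤ∣.∣m+n∣m⇒∣n (∣ᵤ⇒∣ {i = eval (K j) m} p∣Kⱼ[m]) (p∣a*m (a (K j)) m (proj₁ (others j j≢i))))

  witness : Dec (+ p ∣ℤ b (K i)) → PAdmissible k K p
  witness (no p∤bᵢ)  = + 0 , prime∤prodFin pp k _ (p∤K[m] (+ 0) λ p∣Kᵢ[0] →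
    p∤bᵢ (ℤ∣.∣m+n∣m⇒∣n p∣Kᵢ[0] (ℤ∣.∣n⇒∣m*n (+ a (K i)) (∣ᵤ⇒∣ {i = + 0} (p ∣0)))))
  witness (yes p∣bᵢ) = + 1 , prime∤prodFin pp k _ (p∤K[m] (+ 1) λ p∣Kᵢ[1] →
    p∤aᵢ (∣⇒∣ᵤ (subst (+ p ∣ℤ_) (ℤ.*-identityʳ (+ a (K i))) (ℤ∣.∣m+n∣n⇒∣m p∣Kᵢ[1] p∣bᵢ))))

module Reduction {k : ℕ} (L : Fin k → LinForm) (r : Fin k → ℕ) (r>0 : ∀ i → 0 < r i)
                 (t : ℤ) (r∣L[t] : ∀ i → + r i ∣ℤ eval (L i) t) where

  R : ℕ
  R = prodFinℕ k r

  R>0 : 0 < R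
  R>0 = prodFinℕ-pos k r r>0

  s : Fin k → ℤ
  s i = _∣ℤ_.quotient (r∣L[t] i)

  K : Fin k → LinForm
  K i = lin (a (L i) * prodFinℕ-except k i r) (s i)
            (*-positive (a-pos (L i)) (prodFinℕ-except-pos k i r r>0))

  L[R·+t]≐rK : ∀ i → precompose R R>0 t (L i) ≐ r i · K i
  L[R·+t]≐rK i = leading , trans (ℤ.*-comm (+ r i) (s i)) (sym (_∣ℤ_.equality (r∣L[t] i)))
    where
    open ≡-Reasoning
    leading : + r i ℤ.* + (a (L i) * prodFinℕ-except k i r) ≡ + (a (L i) * R)
    leading = begin
      + r i ℤ.* + (a (L i) * prodFinℕ-except k i r) ≡⟨ ℤ.pos-* (r i) _ ⟨
      + (r i * (a (L i) * prodFinℕ-except k i r))   ≡⟨ cong +_ (x∙yz≈y∙xz (r i) (a (L i)) _) ⟩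
      + (a (L i) * (r i * prodFinℕ-except k i r))   ≡⟨ cong (λ z → + (a (L i) * z)) (*-prodFinℕ-except k i r) ⟩
      + (a (L i) * R)                               ∎

  relation : ∀ i j {c c′ n} → RelationWith (L i) (L j) c c′ n →
             RelationWith (K i) (K j) (c * r i) (c′ * r j) n
  relation i j rel = relation-≐· (L[R·+t]≐rK i) (L[R·+t]≐rK j) (relation-precompose {L i} {L j} R R>0 t rel)

  pAdmissible-∣r : ∀ {p} i → Prime p → p ∣ r i →
                   Coprime (r i) (a (L i)) → (∀ j → i ≢ j → Coprime (r i) (det (L i) (L j))) →
                   (∀ i j → i ≢ j → Coprime (r i) (r j)) → PAdmissible k K p
  pAdmissible-∣r {p} i pp p∣rᵢ rᵢ⊥aᵢ rᵢ⊥det r⊥r = pAdmissible-one-nonconstant {K = K} pp i p∤aKᵢ others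
    where
    p∤aKᵢ : ¬ p ∣ a (K i)
    p∤aKᵢ p∣aKᵢ = prime≢1 pp (coprime-*-prodFinℕ-except k i r r⊥r rᵢ⊥aᵢ (p∣rᵢ , p∣aKᵢ))

    p∣L[t] : ∀ j → + p ∣ℤ s j → + p ∣ℤ eval (L j) t
    p∣L[t] j p∣sⱼ = subst (+ p ∣ℤ_) (sym (_∣ℤ_.equality (r∣L[t] j))) (ℤ∣.∣m⇒∣m*n (+ r j) p∣sⱼ)

    others : ∀ j → j ≢ i → p ∣ a (K j) × ¬ + p ∣ℤ s j
    others j j≢i = ∣n⇒∣m*n (a (L j)) (∣-trans p∣rᵢ (∣prodFinℕ-except k j i r (j≢i ∘ sym))) , λ p∣sⱼ →
      prime≢1 pp (rᵢ⊥det j (j≢i ∘ sym)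
        (p∣rᵢ , ∣eval⇒∣det (L i) (L j) t (ℤ∣.∣-trans (∣ᵤ⇒∣ p∣rᵢ) (r∣L[t] i)) (p∣L[t] j p∣sⱼ)))

  admissible : Admissible k L → (∀ i → Coprime (r i) (a (L i))) →
               (∀ i j → i ≢ j → Coprime (r i) (det (L i) (L j))) →
               (∀ i j → i ≢ j → Coprime (r i) (r j)) → Admissible k K
  admissible adm r⊥a r⊥det r⊥r p pp with p ∣? R
  ... | no p∤R  = pAdmissible-≐· r L[R·+t]≐rK
                    (pAdmissible-precompose {L = L} R R>0 t (prime∤⇒coprime pp p∤R) (adm p pp))
  ... | yes p∣R with i , p∣rᵢ ← prime∣prodFinℕ⇒∣ pp k r p∣R =
    pAdmissible-∣r i pp p∣rᵢ (r⊥a i) (r⊥det i) r⊥r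

theorem2p2 : (k : ℕ) → 1 ≤ k →
    (L : Fin k → LinForm) → Admissible k L →
    (c : Fin k → Fin k → ℕ) → (n : Fin k → Fin k → ℕ) →
    (∀ i j → ¬ (i ≡ j) → RelationWith (L i) (L j) (c i j) (c j i) (n i j)) →
    (r : Fin k → ℕ) → (∀ i → 0 < r i) →
    (∀ i → gcd (r i) (LinForm.a (L i)) ≡ 1) →
    (∀ i j → ¬ (i ≡ j) → gcd (r i) (det (L i) (L j)) ≡ 1) →
    (∀ i j → ¬ (i ≡ j) → gcd (r i) (r j) ≡ 1) →
    Σ (Fin k → LinForm) λ K → Admissible k K ×
      (∀ i j → ¬ (i ≡ j) →
        RelationWith (K i) (K j) (c i j * r i) (c j i * r j) (n i j))
theorem2p2 k _ L adm c n rel r r>0 gcd[r,a]≡1 gcd[r,det]≡1 gcd[r,r]≡1 =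
  K , admissible adm r⊥a r⊥det r⊥r , λ i j i≢j → relation i j (rel i j i≢j)
  where
  r⊥a : ∀ i → Coprime (r i) (a (L i))
  r⊥a = gcd≡1⇒coprime ∘ gcd[r,a]≡1

  r⊥det : ∀ i j → i ≢ j → Coprime (r i) (det (L i) (L j))
  r⊥det i j = gcd≡1⇒coprime ∘ gcd[r,det]≡1 i j

  r⊥r : ∀ i j → i ≢ j → Coprime (r i) (r j)
  r⊥r i j = gcd≡1⇒coprime ∘ gcd[r,r]≡1 i j

  solution : ∃ λ t → ∀ i → + r i ∣ℤ eval (L i) t
  solution = linear-congruences-solvable k r (a ∘ L) (b ∘ L) r⊥r r⊥a

  open Reduction L r r>0 (proj₁ solution) (proj₂ solution)
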